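{- Let $I_1,I_2$ be interval-posets and $u$ the interval-poset of size one. Then, whenever the operations are defined (i.e. $I_2$ nonempty for the left grafting, and $0\le i\le\mathrm{contacts}(I_2)$), $\mathrm{dist}(I_1\prec I_2)=\mathrm{dist}(I_1)+\mathrm{dist}(I_2)$ and $\mathrm{dist}(u\succ_i I_2)=\mathrm{dist}(I_2)+\mathrm{contacts}(I_2)-i$.
   Context: An interval-poset of size $n$ is a partial order $\triangleleft$ on $\{1,\dots,n\}$ with $a\triangleleft c\Rightarrow b\triangleleft c$ and $c\triangleleft a\Rightarrow b\triangleleft a$ for all $a<b<c$. It corresponds to a Tamari interval $[T_1,T_2]$ of binary trees (nodes $v_1,\dots,v_n$ in in-order; Tamari order generated by right rotations $y(x(A,B),C)\to x(A,y(B,C))$) via: for $a<b$, $b\triangleleft a$ iff $v_b$ is in the right subtree of $v_a$ in $T_1$, $a\triangleleft b$ iff $v_a$ is in the left subtree of $v_b$ in $T_2$. $\mathrm{dist}(I)$ is the maximal length of a chain from $T_1$ to $T_2$ in the Tamari lattice. $\mathrm{contacts}(I)$ is the number of decreasing roots of $I$ (vertices $b$ with no $a<b$ such that $b\triangleleft a$); equivalently the number of non-final returns to height $0$ of the lower-bound Dyck path. Grafting: for interval-posets $I_1,I_2$ of sizes $n_1,n_2$, the shifted concatenation has the relations of $I_1$ and of $I_2$ shifted by $n_1$. For $n_2>0$, $I_1\prec I_2$ adds $y\triangleleft n_1+1$ for all $y\le n_1$ (and $\emptyset\prec I_2=I_2$). For $n_1>0$ and $0\le r\le c$, with $y_1<\dots<y_c$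 the decreasing roots of $I_2$ shifted by $n_1$, $I_1\succ_r I_2$ adds $y_i\triangleleft n_1$ for $1\le i\le r$ (and $I_1\succ_0\emptyset=I_1$). -}

module Defs where

open import Data.Nat using (ℕ; zero; suc; _+_; _∸_; _≤_; _<_)
open import Data.Product using (Σ; ∃; ∃-syntax; _×_; _,_)
open import Data.Sum using (_⊎_)
open import Data.Empty using (⊥)
open import Data.List using (List; take; length)
open import Data.List.Membership.Propositional using (_∈_)
open import Data.List.Relation.Unary.Linked using (Linked)
open import Relation.Nullary using (¬_)
open import Relation.Binary.PropositionalEquality using (_≡_; _≢_)
open import Relation.Binary.Construct.Closure.Transitive using (TransClosure)
open import Relation.Binary.Construct.Closure.ReflexiveTransitive using (Star)
open import Function.Bundles using (_⇔_)

-- Relations on the vertices.  Vertices are the natural numbers 1..n;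
-- a relation R a b is read  a ◁ b.

Relℕ : Set₁
Relℕ = ℕ → ℕ → Set

record IsIntervalPoset (n : ℕ) (R : Relℕ) : Set where
  field
    support  : ∀ {a b} → R a b → (1 ≤ a × a ≤ n) × (1 ≤ b × b ≤ n)
    reflexive : ∀ {a} → 1 ≤ a → a ≤ n → R a a
    antisym  : ∀ {a b} → R a b → R b a → a ≡ b
    trans    : ∀ {a b c} → R a b → R b c → R a c
    cond₁    : ∀ {a b c} → a < b → b < c → R a c → R b c
    cond₂    : ∀ {a b c} → a < b → b < c → R c a → R b a

data Tree : Set where
  leaf : Tree
  node : Tree → Tree → Tree

size : Tree → ℕ
size leaf       = 0
size (node l r) = size l + 1 + size r

-- Nodes of T are labelled k+1,…,k+size T in in-order (offset k).
-- RightDesc T k a b : node v_b lies in the right subtree of node v_a.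
RightDesc : Tree → ℕ → ℕ → ℕ → Set
RightDesc leaf       k a b = ⊥
RightDesc (node l r) k a b =
  (a ≡ k + size l + 1 × k + size l + 1 < b × b ≤ k + size l + 1 + size r)
  ⊎ RightDesc l k a b
  ⊎ RightDesc r (k + size l + 1) a b

LeftDesc : Tree → ℕ → ℕ → ℕ → Set
LeftDesc leaf       k a b = ⊥
LeftDesc (node l r) k a b =
  (b ≡ k + size l + 1 × k < a × a < k + size l + 1)
  ⊎ LeftDesc l k a b
  ⊎ LeftDesc r (k + size l + 1) a b

data _⟶_ : Tree → Tree → Set where
  rot    : ∀ {A B C} → node (node A B) C ⟶ node A (node B C)
  inLeft : ∀ {T T' C} → T ⟶ T' → node T C ⟶ node T' C
  inRight : ∀ {C T T'} → T ⟶ T' → node C T ⟶ node C T'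

_≤T_ : Tree → Tree → Set
_≤T_ = Star _⟶_

_<T_ : Tree → Tree → Set
S <T T = S ≤T T × S ≢ T

data Chain : ℕ → Tree → Tree → Set where
  done : ∀ {T} → Chain 0 T T
  step : ∀ {k S U T} → S <T U → Chain k U T → Chain (suc k) S T

MaxChainLength : Tree → Tree → ℕ → Set
MaxChainLength T₁ T₂ d = Chain d T₁ T₂ × (∀ k → Chain k T₁ T₂ → k ≤ d)

Corresponds : ℕ → Relℕ → Tree → Tree → Set
Corresponds n R T₁ T₂ =
  size T₁ ≡ n × size T₂ ≡ n
  × (∀ a b → a < b → (R b a ⇔ RightDesc T₁ 0 a b))
  × (∀ a b → a < b → (R a b ⇔ LeftDesc T₂ 0 a b))

DistIs : ℕ → Relℕ → ℕ → Set
DistIs n R d = ∃[ T₁ ] ∃[ T₂ ] (Corresponds n R T₁ T₂ × MaxChainLength T₁ T₂ d)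

IsDecRoot : ℕ → Relℕ → ℕ → Set
IsDecRoot n R b = 1 ≤ b × b ≤ n × (∀ a → a < b → ¬ R b a)

-- ys is the increasing list y₁ < … < y_c of all decreasing roots;
-- contacts(I) = length ys.
DecRoots : ℕ → Relℕ → List ℕ → Set
DecRoots n R ys = Linked _<_ ys × (∀ b → (b ∈ ys ⇔ IsDecRoot n R b))

concatRel : ℕ → Relℕ → Relℕ → Relℕ
concatRel n₁ R₁ R₂ a b = R₁ a b ⊎ (n₁ < a × n₁ < b × R₂ (a ∸ n₁) (b ∸ n₁))

leftGraft : ℕ → Relℕ → Relℕ → Relℕ
leftGraft n₁ R₁ R₂ = TransClosure base
  where
  base : Relℕ
  base a b = concatRel n₁ R₁ R₂ a b ⊎ (1 ≤ a × a ≤ n₁ × b ≡ suc n₁)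

-- I₁ ≻_r I₂, where ys is the increasing list of decreasing roots of I₂
rightGraft : ℕ → Relℕ → Relℕ → List ℕ → ℕ → Relℕ
rightGraft n₁ R₁ R₂ ys r = TransClosure base
  where
  base : Relℕ
  base a b = concatRel n₁ R₁ R₂ a b ⊎ (b ≡ n₁ × ∃[ y ] (y ∈ take r ys × a ≡ n₁ + y))

uRel : Relℕ
uRel a b = a ≡ 1 × b ≡ 1

module Submission where

-- An interval-poset I with dist(I) = d is given by a Tamari interval
-- [T₁,T₂] whose longest chains have length d.  Both graftings are realised
-- on trees, and the distance is computed there.
--
-- * I₁ ≺ I₂ corresponds to grafting the trees of I₁ onto the leftmost leaves
--   of the trees of I₂ (graftLeft).  Every tree of a chain between two such
--   grafts is again a graft (SpineCut), so a chain splits into a chain for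
--   I₁ and one for I₂, and distances add (graftLeft-maxChain).
-- * u ≻_i I₂ corresponds to inserting a new first node at depth
--   j = contacts(I₂) − i of the left spine of T₁ and at the root of T₂
--   (insertSpine), since the decreasing roots of I₂ are the left spine of T₁.
--   Raising the new node to the root takes j rotations; conversely deleting
--   the first node turns a chain into a chain, losing only steps that shorten
--   the left spine (deleteFirst-chain).  So the distance grows by exactly j.

open import Defs
open import Data.Nat using (ℕ; _+_; _∸_; _≤_; _<_)
open import Data.Product using (_×_)
open import Data.List using (List; length)

open import Data.Nat using (zero; suc; z≤n; s≤s)
open import Data.Nat.Properties
open import Data.Nat.Tactic.RingSolver using (solve-∀)
open import Data.Product using (Σ; _,_; proj₁; proj₂)
open import Data.Sum using (_⊎_; inj₁; inj₂)
open import Data.Empty using (⊥; ⊥-elim)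
open import Data.Unit using (⊤; tt)
open import Data.List using ([]; _∷_; _++_; take)
open import Data.List.Properties using (length-++; take-all)
open import Data.List.Membership.Propositional using (_∈_)
open import Data.List.Membership.Propositional.Properties using (∈-++⁻; ∈-++⁺ˡ; ∈-++⁺ʳ)
open import Data.List.Relation.Unary.Any using (here; there)
open import Data.List.Relation.Unary.Linked using (Linked; []; [-]; _∷_)
import Data.List.Relation.Unary.Linked as Linked
open import Relation.Nullary using (¬_; Dec; yes; no)
open import Relation.Binary.Definitions using (tri<; tri≈; tri>)
open import Relation.Binary.PropositionalEquality
  using (_≡_; _≢_; refl; sym; trans; cong; cong₂; subst; module ≡-Reasoning)
open import Relation.Binary.Construct.Closure.ReflexiveTransitive using (ε; _◅_; _◅◅_)
open import Relation.Binary.Construct.Closure.Transitive using ([_]; _∷_)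
open import Function.Bundles using (_⇔_; mk⇔; Equivalence)

-- Trees with decidable equality: needed to decide whether a Tamari step
-- S ≤T T between consecutive chain elements is strict.
node-injective : ∀ {l r l' r'} → node l r ≡ node l' r' → l ≡ l' × r ≡ r'
node-injective refl = refl , refl

_≟T_ : (S T : Tree) → Dec (S ≡ T)
leaf     ≟T leaf       = yes refl
leaf     ≟T node _ _   = no (λ ())
node _ _ ≟T leaf       = no (λ ())
node l r ≟T node l' r' with l ≟T l' | r ≟T r'
... | yes refl | yes refl = yes refl
... | no l≢l'  | _        = no (λ e → l≢l' (proj₁ (node-injective e)))
... | yes _    | no r≢r'  = no (λ e → r≢r' (proj₂ (node-injective e)))

NonLeaf : Tree → Set
NonLeaf leaf       = ⊥
NonLeaf (node _ _) = ⊤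

size-left< : ∀ l r → size l < size (node l r)
size-left< l r = <-≤-trans (m<m+n (size l) (s≤s z≤n)) (m≤m+n (size l + 1) (size r))

size-node-pos : ∀ l r → 0 < size (node l r)
size-node-pos l r = ≤-<-trans z≤n (size-left< l r)

size-⟶ : ∀ {X Y} → X ⟶ Y → size X ≡ size Y
size-⟶ (rot {A} {B} {C}) = reassoc (size A) (size B) (size C)
  where
  reassoc : ∀ a b c → a + 1 + b + 1 + c ≡ a + 1 + (b + 1 + c)
  reassoc = solve-∀
size-⟶ (inLeft {C = C} r)  = cong (λ s → s + 1 + size C) (size-⟶ r)
size-⟶ (inRight {C} r)     = cong (λ s → size C + 1 + s) (size-⟶ r)

-- The potential of a tree sums, over all nodes, the size of the right
-- subtree.  Every rotation increases it strictly, so a nonempty sequence of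
-- rotations never returns to its starting tree.
potential : Tree → ℕ
potential leaf       = 0
potential (node l r) = potential l + potential r + size r

potential-⟶ : ∀ {X Y} → X ⟶ Y → potential X < potential Y
potential-⟶ (rot {A} {B} {C}) =
  subst (potential (node (node A B) C) <_) (gain (potential A) (potential B) (potential C) (size B) (size C))
        (m<m+n _ (s≤s z≤n))
  where
  gain : ∀ a b c sb sc → a + b + sb + c + sc + (1 + sc) ≡ a + (b + c + sc) + (sb + 1 + sc)
  gain = solve-∀
potential-⟶ (inLeft {C = C} r) = +-monoˡ-< (size C) (+-monoˡ-< (potential C) (potential-⟶ r))
potential-⟶ (inRight {C} r) =
  +-mono-<-≤ (+-monoʳ-< (potential C) (potential-⟶ r)) (≤-reflexive (size-⟶ r))

potential-≤T : ∀ {X Y} → X ≤T Y → potential X ≤ potential Y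
potential-≤T ε        = ≤-refl
potential-≤T (r ◅ rs) = ≤-trans (<⇒≤ (potential-⟶ r)) (potential-≤T rs)

potential-⟶≤T : ∀ {X Y Z} → X ⟶ Y → Y ≤T Z → potential X < potential Z
potential-⟶≤T r rs = <-≤-trans (potential-⟶ r) (potential-≤T rs)

rotations-change : ∀ {X Y Z} → X ⟶ Y → Y ≤T Z → X ≢ Z
rotations-change r rs refl = <-irrefl refl (potential-⟶≤T r rs)

chain⇒≤T : ∀ {k X Y} → Chain k X Y → X ≤T Y
chain⇒≤T done             = ε
chain⇒≤T (step (s , _) c) = s ◅◅ chain⇒≤T c

chain-++ : ∀ {k m X Y Z} → Chain k X Y → Chain m Y Z → Chain (k + m) X Z
chain-++ done       c' = c'
chain-++ (step s c) c' = step s (chain-++ c c')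

-- A tree context f carrying rotations to rotations (plugging into a node,
-- grafting, inserting a spine node) carries chains to chains of the same
-- length; this gives the lower bounds on distances.
RotationContext : (Tree → Tree) → Set
RotationContext f = ∀ {X Y} → X ⟶ Y → f X ⟶ f Y

map-≤T : ∀ {f} → RotationContext f → ∀ {X Y} → X ≤T Y → f X ≤T f Y
map-≤T fr ε        = ε
map-≤T fr (r ◅ rs) = fr r ◅ map-≤T fr rs

map-<T : ∀ {f} → RotationContext f → ∀ {X Y} → X <T Y → f X <T f Y
map-<T fr (ε , X≢X)     = ⊥-elim (X≢X refl)
map-<T fr (r ◅ rs , _)  = fr r ◅ map-≤T fr rs , rotations-change (fr r) (map-≤T fr rs)

map-chain : ∀ {f} → RotationContext f → ∀ {k X Y} → Chain k X Y → Chain k (f X) (f Y)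
map-chain fr done       = done
map-chain fr (step s c) = step (map-<T fr s) (map-chain fr c)

prepend-≤T : ∀ {m S S' T} → S ≤T S' → Chain m S' T → Σ ℕ λ m' → m ≤ m' × Chain m' S T
prepend-≤T {m} {S} {S'} s c with S ≟T S'
... | yes refl = m , ≤-refl , c
... | no S≢S'  = suc m , n≤1+n m , step (s , S≢S') c

-- graftLeft A S plugs A into the leftmost leaf of S.  In-order, the nodes
-- of A come first, then those of S; this is the tree-level form of I₁ ≺ I₂.
graftLeft : Tree → Tree → Tree
graftLeft A leaf       = A
graftLeft A (node l r) = node (graftLeft A l) r

size-graftLeft : ∀ A S → size (graftLeft A S) ≡ size A + size S
size-graftLeft A leaf       = sym (+-identityʳ (size A))
size-graftLeft A (node l r) =
  trans (cong (λ s → s + 1 + size r) (size-graftLeft A l)) (reassoc (size A) (size l) (size r))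
  where
  reassoc : ∀ a b c → a + b + 1 + c ≡ a + (b + 1 + c)
  reassoc = solve-∀

graftLeft-mapˡ : ∀ S → RotationContext (λ A → graftLeft A S)
graftLeft-mapˡ leaf       r = r
graftLeft-mapˡ (node l _) r = inLeft (graftLeft-mapˡ l r)

graftLeft-mapʳ : ∀ A → RotationContext (graftLeft A)
graftLeft-mapʳ A rot         = rot
graftLeft-mapʳ A (inLeft r)  = inLeft (graftLeft-mapʳ A r)
graftLeft-mapʳ A (inRight r) = inRight r

graftLeft-grows : ∀ A l r → size A < size (graftLeft A (node l r))
graftLeft-grows A l r =
  subst (size A <_) (sym (size-graftLeft A (node l r))) (m<m+n (size A) (size-node-pos l r))

graftLeft-injective : ∀ A A' S S' → size A ≡ size A' →
  graftLeft A S ≡ graftLeft A' S' → A ≡ A' × S ≡ S'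
graftLeft-injective A A' leaf leaf _ e = e , refl
graftLeft-injective A A' leaf (node l r) |A|≡|A'| e =
  ⊥-elim (<-irrefl (trans (sym |A|≡|A'|) (cong size e)) (graftLeft-grows A' l r))
graftLeft-injective A A' (node l r) leaf |A|≡|A'| e =
  ⊥-elim (<-irrefl (trans |A|≡|A'| (cong size (sym e))) (graftLeft-grows A l r))
graftLeft-injective A A' (node l r) (node l' r') |A|≡|A'| e with node-injective e
... | e₁ , refl with graftLeft-injective A A' l l' |A|≡|A'| e₁
... | refl , refl = refl , refl

-- SpineCut n T: some node of the left spine of T has a left subtree of
-- exactly n nodes.  graftLeft A S has this property for n = size A, and it
-- is inherited downwards along rotations; it forces every tree of a chain
-- between two grafts to be itself a graft.
SpineCut : ℕ → Tree → Set
SpineCut n leaf       = ⊥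
SpineCut n (node l r) = size l ≡ n ⊎ SpineCut n l

spineCut-bound : ∀ {n} T → SpineCut n T → n < size T
spineCut-bound (node l r) (inj₁ refl) = size-left< l r
spineCut-bound (node l r) (inj₂ c)    = <-trans (spineCut-bound l c) (size-left< l r)

spineCut-graftLeft : ∀ A S → NonLeaf S → SpineCut (size A) (graftLeft A S)
spineCut-graftLeft A (node leaf _)       _ = inj₁ refl
spineCut-graftLeft A (node (node l r) _) _ = inj₂ (spineCut-graftLeft A (node l r) tt)

spineCut-⟵ : ∀ {n Y Z} → Y ⟶ Z → SpineCut n Z → SpineCut n Y
spineCut-⟵ rot         c        = inj₂ c
spineCut-⟵ (inLeft r)  (inj₁ e) = inj₁ (trans (size-⟶ r) e)
spineCut-⟵ (inLeft r)  (inj₂ c) = inj₂ (spineCut-⟵ r c)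
spineCut-⟵ (inRight r) c        = c

spineCut-⟵≤T : ∀ {n Y Z} → Y ≤T Z → SpineCut n Z → SpineCut n Y
spineCut-⟵≤T ε        c = c
spineCut-⟵≤T (r ◅ rs) c = spineCut-⟵ r (spineCut-⟵≤T rs c)

graftLeft-⟶ : ∀ A S → NonLeaf S → ∀ {Y} → graftLeft A S ⟶ Y → SpineCut (size A) Y →
  (Σ Tree λ A' → A ⟶ A' × Y ≡ graftLeft A' S) ⊎ (Σ Tree λ S' → S ⟶ S' × Y ≡ graftLeft A S')
graftLeft-⟶ A (node leaf r) _ (inRight x) _ = inj₂ (_ , inRight x , refl)
graftLeft-⟶ A (node leaf r) _ (inLeft x)  _ = inj₁ (_ , x , refl)
graftLeft-⟶ A (node leaf r) _ (rot {P} {Q}) (inj₁ e) = ⊥-elim (<-irrefl e (size-left< P Q))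
graftLeft-⟶ A (node leaf r) _ (rot {P} {Q}) (inj₂ c) =
  ⊥-elim (<-irrefl refl (<-trans (spineCut-bound P c) (size-left< P Q)))
graftLeft-⟶ A (node (node a b) r) _ (inRight x) _ = inj₂ (_ , inRight x , refl)
graftLeft-⟶ A (node (node a b) r) _ rot         _ = inj₂ (_ , rot , refl)
graftLeft-⟶ A (node (node a b) r) _ (inLeft x) (inj₁ e) =
  ⊥-elim (<-irrefl (sym e) (subst (size A <_) (size-⟶ x) (graftLeft-grows A a b)))
graftLeft-⟶ A (node (node a b) r) _ (inLeft x) (inj₂ c) with graftLeft-⟶ A (node a b) tt x c
... | inj₁ (A' , y , refl) = inj₁ (A' , y , refl)
... | inj₂ (S' , y , refl) = inj₂ (node S' r , inLeft y , refl)

graftLeft-≤T : ∀ A S → NonLeaf S → ∀ {Y} → graftLeft A S ≤T Y → SpineCut (size A) Y →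
  Σ Tree λ A' → Σ Tree λ S' →
    A ≤T A' × S ≤T S' × NonLeaf S' × size A' ≡ size A × Y ≡ graftLeft A' S'
graftLeft-≤T A S nS ε _ = A , S , ε , ε , nS , refl , refl
graftLeft-≤T A S nS (x ◅ xs) c with graftLeft-⟶ A S nS x (spineCut-⟵≤T xs c)
... | inj₁ (A₁ , y , refl) with graftLeft-≤T A₁ S nS xs (subst (λ n → SpineCut n _) (size-⟶ y) c)
...   | A' , S' , sA , sS , nS' , sz , e = A' , S' , y ◅ sA , sS , nS' , trans sz (sym (size-⟶ y)) , e
graftLeft-≤T A S nS (x ◅ xs) c | inj₂ (node _ _ , y , refl) with graftLeft-≤T A _ tt xs c
... | A' , S' , sA , sS , nS' , sz , e = A' , S' , sA , y ◅ sS , nS' , sz , e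

graftLeft-chain-split : ∀ {k X Z} → Chain k X Z → ∀ A S A₂ S₂ → NonLeaf S → NonLeaf S₂ →
  size A₂ ≡ size A → X ≡ graftLeft A S → Z ≡ graftLeft A₂ S₂ →
  Σ ℕ λ kA → Σ ℕ λ kS → k ≤ kA + kS × Chain kA A A₂ × Chain kS S S₂
graftLeft-chain-split done A S A₂ S₂ _ _ sz refl e with graftLeft-injective A A₂ S S₂ (sym sz) e
... | refl , refl = 0 , 0 , z≤n , done , done
graftLeft-chain-split {suc k} (step (s , X≢U) c) A S A₂ S₂ nS nS₂ sz refl refl
  with graftLeft-≤T A S nS s
         (spineCut-⟵≤T (chain⇒≤T c) (subst (λ n → SpineCut n _) sz (spineCut-graftLeft A₂ S₂ nS₂)))
... | A' , S' , sA , sS , nS' , szA' , refl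
  with graftLeft-chain-split c A' S' A₂ S₂ nS' nS₂ (trans sz (sym szA')) refl refl
... | kA , kS , k≤ , cA , cS with A ≟T A'
... | yes refl = kA , suc kS , subst (suc k ≤_) (sym (+-suc kA kS)) (s≤s k≤) ,
                 cA , step (sS , (λ e → X≢U (cong (graftLeft A) e))) cS
... | no A≢A' with prepend-≤T sS cS
... | kS' , kS≤ , cS' = suc kA , kS' , s≤s (≤-trans k≤ (+-monoʳ-≤ kA kS≤)) , step (sA , A≢A') cA , cS'

graftLeft-maxChain : ∀ A₁ A₂ S₁ S₂ d₁ d₂ → NonLeaf S₁ → NonLeaf S₂ → size A₁ ≡ size A₂ →
  MaxChainLength A₁ A₂ d₁ → MaxChainLength S₁ S₂ d₂ →
  MaxChainLength (graftLeft A₁ S₁) (graftLeft A₂ S₂) (d₁ + d₂)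
graftLeft-maxChain A₁ A₂ S₁ S₂ d₁ d₂ nS₁ nS₂ sz (cA , maxA) (cS , maxS) =
  chain-++ (map-chain (graftLeft-mapˡ S₁) cA) (map-chain (graftLeft-mapʳ A₂) cS) ,
  λ k c → let (kA , kS , k≤ , cA' , cS') = graftLeft-chain-split c A₁ S₁ A₂ S₂ nS₁ nS₂ (sym sz) refl refl
          in ≤-trans k≤ (+-mono-≤ (maxA kA cA') (maxS kS cS'))

-- This is the
-- lower tree of u ≻_i I₂ when j = contacts(I₂) − i.
insertSpine : ℕ → Tree → Tree
insertSpine zero    S          = node leaf S
insertSpine (suc j) leaf       = node leaf leaf
insertSpine (suc j) (node l r) = node (insertSpine j l) r

spineLength : Tree → ℕ
spineLength leaf       = 0
spineLength (node l r) = suc (spineLength l)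

deleteFirst : Tree → Tree
deleteFirst leaf                = leaf
deleteFirst (node leaf r)       = r
deleteFirst (node (node a b) r) = node (deleteFirst (node a b)) r

insertSpine-nonLeaf : ∀ j S → NonLeaf (insertSpine j S)
insertSpine-nonLeaf zero    S          = tt
insertSpine-nonLeaf (suc j) leaf       = tt
insertSpine-nonLeaf (suc j) (node l r) = tt

deleteFirst-under : ∀ T r → NonLeaf T → deleteFirst (node T r) ≡ node (deleteFirst T) r
deleteFirst-under (node _ _) r _ = refl

deleteFirst-insertSpine : ∀ j S → deleteFirst (insertSpine j S) ≡ S
deleteFirst-insertSpine zero    S          = refl
deleteFirst-insertSpine (suc j) leaf       = refl
deleteFirst-insertSpine (suc j) (node l r) =
  trans (deleteFirst-under (insertSpine j l) r (insertSpine-nonLeaf j l))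
        (cong (λ D → node D r) (deleteFirst-insertSpine j l))

spineLength-insertSpine : ∀ j S → spineLength (insertSpine j S) ≤ suc j
spineLength-insertSpine zero    S          = ≤-refl
spineLength-insertSpine (suc j) leaf       = s≤s z≤n
spineLength-insertSpine (suc j) (node l r) = s≤s (spineLength-insertSpine j l)

-- A rotation either leaves the tree without its first node unchanged while
-- shortening the left spine (the rotation at the first node's parent), or
-- induces a rotation of that smaller tree without lengthening the spine.
deleteFirst-⟶ : ∀ {X Y} → X ⟶ Y →
  (deleteFirst X ≡ deleteFirst Y × spineLength Y < spineLength X)
  ⊎ (deleteFirst X ⟶ deleteFirst Y × spineLength Y ≤ spineLength X)
deleteFirst-⟶ (rot {leaf})     = inj₁ (refl , ≤-refl)
deleteFirst-⟶ (rot {node _ _}) = inj₂ (rot , n≤1+n _)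
deleteFirst-⟶ (inLeft {leaf} ())
deleteFirst-⟶ (inLeft {node _ _} {leaf} ())
deleteFirst-⟶ (inLeft {node _ _} {node _ _} r) with deleteFirst-⟶ r
... | inj₁ (e , lt) = inj₁ (cong (λ D → node D _) e , s≤s lt)
... | inj₂ (x , le) = inj₂ (inLeft x , s≤s le)
deleteFirst-⟶ (inRight {leaf} r)     = inj₂ (r , ≤-refl)
deleteFirst-⟶ (inRight {node _ _} r) = inj₂ (inRight r , ≤-refl)

deleteFirst-≤T : ∀ {X Y} → X ≤T Y →
  deleteFirst X ≤T deleteFirst Y × spineLength Y ≤ spineLength X
  × (X ≢ Y → deleteFirst X ≡ deleteFirst Y → spineLength Y < spineLength X)
deleteFirst-≤T ε = ε , ≤-refl , λ X≢X _ → ⊥-elim (X≢X refl)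
deleteFirst-≤T (x ◅ xs) with deleteFirst-≤T xs | deleteFirst-⟶ x
... | s , le , _ | inj₁ (e , lt) =
  subst (λ D → D ≤T _) (sym e) s , ≤-trans le (<⇒≤ lt) , λ _ _ → ≤-<-trans le lt
... | s , le , _ | inj₂ (y , le') =
  y ◅ s , ≤-trans le le' , λ _ e → ⊥-elim (<-irrefl (cong potential e) (potential-⟶≤T y s))

-- Upper bound: each step of a chain either survives the deletion of the
-- first node or shortens the left spine.
deleteFirst-chain : ∀ {k X Y} → Chain k X Y →
  Σ ℕ λ m → Chain m (deleteFirst X) (deleteFirst Y) × k + spineLength Y ≤ m + spineLength X
deleteFirst-chain done = 0 , done , ≤-refl
deleteFirst-chain {suc k} {X} {Y} (step {U = U} (s , X≢U) c)
  with deleteFirst-chain c | deleteFirst-≤T s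
... | m , cm , le | ds , spU≤spX , shorter with deleteFirst X ≟T deleteFirst U
... | no d≢ = suc m , step (ds , d≢) cm , s≤s (≤-trans le (+-monoʳ-≤ m spU≤spX))
... | yes d≡ = m , subst (λ D → Chain m D _) (sym d≡) cm ,
               ≤-trans (s≤s le)
                 (subst (_≤ m + spineLength X) (+-suc m (spineLength U))
                        (+-monoʳ-≤ m (shorter X≢U d≡)))

insertSpine-⟶ : ∀ j S → suc j ≤ spineLength S → insertSpine (suc j) S ⟶ insertSpine j S
insertSpine-⟶ zero    (node l r) _         = rot
insertSpine-⟶ (suc j) (node l r) (s≤s j<) = inLeft (insertSpine-⟶ j l j<)

insertSpine-chain : ∀ j S → j ≤ spineLength S → Chain j (insertSpine j S) (node leaf S)
insertSpine-chain zero    S _  = done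
insertSpine-chain (suc j) S j≤ =
  step (r ◅ ε , rotations-change r ε) (insertSpine-chain j S (≤-trans (n≤1+n j) j≤))
  where r = insertSpine-⟶ j S j≤

insertSpine-maxChain : ∀ j S₁ S₂ d → j ≤ spineLength S₁ → MaxChainLength S₁ S₂ d →
  MaxChainLength (insertSpine j S₁) (node leaf S₂) (j + d)
insertSpine-maxChain j S₁ S₂ d j≤ (c , maxS) =
  chain-++ (insertSpine-chain j S₁ j≤) (map-chain inRight c) , upper
  where
  open ≤-Reasoning
  upper : ∀ k → Chain k (insertSpine j S₁) (node leaf S₂) → k ≤ j + d
  upper k ch with deleteFirst-chain ch
  ... | m , cm , le = ≤-pred (begin
      suc k                                     ≡⟨ +-comm 1 k ⟩
      k + 1                                     ≤⟨ le ⟩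
      m + spineLength (insertSpine j S₁)        ≤⟨ +-mono-≤ (maxS m cm') (spineLength-insertSpine j S₁) ⟩
      d + suc j                                 ≡⟨ +-suc d j ⟩
      suc (d + j)                               ≡⟨ cong suc (+-comm d j) ⟩
      suc (j + d)                               ∎)
    where cm' = subst (λ D → Chain m D S₂) (deleteFirst-insertSpine j S₁) cm

-- In a tree labelled from offset k + 1, the root of node l r carries the
-- label k + size l + 1; the following arithmetic facts locate it.
label<root : ∀ k s → k + s < k + s + 1
label<root k s = m<m+n (k + s) (s≤s z≤n)

offset<root : ∀ k s → k < k + s + 1
offset<root k s = ≤-<-trans (m≤m+n k s) (label<root k s)

last-label : ∀ k l r → k + (l + 1 + r) ≡ k + l + 1 + r
last-label = solve-∀

left-block≤ : ∀ k l r → k + l ≤ k + (l + 1 + r)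
left-block≤ k l r = +-monoʳ-≤ k (≤-trans (m≤m+n l 1) (m≤m+n (l + 1) r))

root-right-end : ∀ k l r → k + size l + 1 + size r ≤ k + size (node l r)
root-right-end k l r = ≤-reflexive (sym (last-label k (size l) (size r)))

-- The first disjuncts of RightDesc and LeftDesc: a is the root ρ and b
-- lies in its right subtree of s nodes; b is the root ρ and a lies in
-- its left subtree, whose labels exceed k.
RootRight : ℕ → ℕ → ℕ → ℕ → Set
RootRight ρ s a b = a ≡ ρ × ρ < b × b ≤ ρ + s

RootLeft : ℕ → ℕ → ℕ → ℕ → Set
RootLeft k ρ a b = b ≡ ρ × k < a × a < ρ

rightDesc-bounds : ∀ T k {a b} → RightDesc T k a b → k < a × a < b × b ≤ k + size T
rightDesc-bounds (node l r) k (inj₁ (refl , a<b , b≤)) =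
  offset<root k (size l) , a<b , ≤-trans b≤ (root-right-end k l r)
rightDesc-bounds (node l r) k (inj₂ (inj₁ x)) with rightDesc-bounds l k x
... | k<a , a<b , b≤ = k<a , a<b , ≤-trans b≤ (left-block≤ k (size l) (size r))
rightDesc-bounds (node l r) k (inj₂ (inj₂ x)) with rightDesc-bounds r (k + size l + 1) x
... | ρ<a , a<b , b≤ = <-trans (offset<root k (size l)) ρ<a , a<b , ≤-trans b≤ (root-right-end k l r)

leftDesc-bounds : ∀ T k {a b} → LeftDesc T k a b → k < a × a < b × b ≤ k + size T
leftDesc-bounds (node l r) k (inj₁ (refl , k<a , a<b)) =
  k<a , a<b , ≤-trans (m≤m+n _ (size r)) (root-right-end k l r)
leftDesc-bounds (node l r) k (inj₂ (inj₁ x)) with leftDesc-bounds l k x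
... | k<a , a<b , b≤ = k<a , a<b , ≤-trans b≤ (left-block≤ k (size l) (size r))
leftDesc-bounds (node l r) k (inj₂ (inj₂ x)) with leftDesc-bounds r (k + size l + 1) x
... | ρ<a , a<b , b≤ = <-trans (offset<root k (size l)) ρ<a , a<b , ≤-trans b≤ (root-right-end k l r)

OnSpine : Tree → ℕ → ℕ → Set
OnSpine leaf       k b = ⊥
OnSpine (node l r) k b = b ≡ k + size l + 1 ⊎ OnSpine l k b

onSpine-bounds : ∀ T k {b} → OnSpine T k b → k < b × b ≤ k + size T
onSpine-bounds (node l r) k (inj₁ refl) =
  offset<root k (size l) , ≤-trans (m≤m+n _ (size r)) (root-right-end k l r)
onSpine-bounds (node l r) k (inj₂ o) with onSpine-bounds l k o
... | k<b , b≤ = k<b , ≤-trans b≤ (left-block≤ k (size l) (size r))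

-- Shifting all labels by m.  The shifted copy of I₂ in a grafting is read
-- off the trees of I₂ labelled from offset n₁.
shift-label : ∀ m k l → m + (k + l + 1) ≡ m + k + l + 1
shift-label = solve-∀

rootRight-shift : ∀ m ρ s {a b} → RootRight ρ s a b → RootRight (m + ρ) s (m + a) (m + b)
rootRight-shift m ρ s (refl , ρ<b , b≤) =
  refl , +-monoʳ-< m ρ<b , ≤-trans (+-monoʳ-≤ m b≤) (≤-reflexive (sym (+-assoc m ρ s)))

rootRight-unshift : ∀ m ρ s {a b} → RootRight (m + ρ) s (m + a) (m + b) → RootRight ρ s a b
rootRight-unshift m ρ s (e , ρ<b , b≤) =
  +-cancelˡ-≡ m _ _ e , +-cancelˡ-< m _ _ ρ<b , +-cancelˡ-≤ m _ _ (≤-trans b≤ (≤-reflexive (+-assoc m ρ s)))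

rootLeft-shift : ∀ m k ρ {a b} → RootLeft k ρ a b → RootLeft (m + k) (m + ρ) (m + a) (m + b)
rootLeft-shift m k ρ (refl , k<a , a<ρ) = refl , +-monoʳ-< m k<a , +-monoʳ-< m a<ρ

rootLeft-unshift : ∀ m k ρ {a b} → RootLeft (m + k) (m + ρ) (m + a) (m + b) → RootLeft k ρ a b
rootLeft-unshift m k ρ (e , k<a , a<ρ) = +-cancelˡ-≡ m _ _ e , +-cancelˡ-< m _ _ k<a , +-cancelˡ-< m _ _ a<ρ

rightDesc-+ : ∀ T m k {a b} → RightDesc T k a b → RightDesc T (m + k) (m + a) (m + b)
rightDesc-+ (node l r) m k {a} {b} (inj₁ t) =
  inj₁ (subst (λ ρ → RootRight ρ (size r) (m + a) (m + b)) (shift-label m k (size l)) (rootRight-shift m _ (size r) t))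
rightDesc-+ (node l r) m k (inj₂ (inj₁ x)) = inj₂ (inj₁ (rightDesc-+ l m k x))
rightDesc-+ (node l r) m k {a} {b} (inj₂ (inj₂ x)) =
  inj₂ (inj₂ (subst (λ k' → RightDesc r k' (m + a) (m + b)) (shift-label m k (size l)) (rightDesc-+ r m _ x)))

rightDesc-∸ : ∀ T m k {a b} → RightDesc T (m + k) (m + a) (m + b) → RightDesc T k a b
rightDesc-∸ (node l r) m k {a} {b} (inj₁ t) =
  inj₁ (rootRight-unshift m _ (size r) (subst (λ ρ → RootRight ρ (size r) (m + a) (m + b)) (sym (shift-label m k (size l))) t))
rightDesc-∸ (node l r) m k (inj₂ (inj₁ x)) = inj₂ (inj₁ (rightDesc-∸ l m k x))
rightDesc-∸ (node l r) m k {a} {b} (inj₂ (inj₂ x)) =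
  inj₂ (inj₂ (rightDesc-∸ r m _ (subst (λ k' → RightDesc r k' (m + a) (m + b)) (sym (shift-label m k (size l))) x)))

leftDesc-+ : ∀ T m k {a b} → LeftDesc T k a b → LeftDesc T (m + k) (m + a) (m + b)
leftDesc-+ (node l r) m k {a} {b} (inj₁ t) =
  inj₁ (subst (λ ρ → RootLeft (m + k) ρ (m + a) (m + b)) (shift-label m k (size l)) (rootLeft-shift m k _ t))
leftDesc-+ (node l r) m k (inj₂ (inj₁ x)) = inj₂ (inj₁ (leftDesc-+ l m k x))
leftDesc-+ (node l r) m k {a} {b} (inj₂ (inj₂ x)) =
  inj₂ (inj₂ (subst (λ k' → LeftDesc r k' (m + a) (m + b)) (shift-label m k (size l)) (leftDesc-+ r m _ x)))

leftDesc-∸ : ∀ T m k {a b} → LeftDesc T (m + k) (m + a) (m + b) → LeftDesc T k a b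
leftDesc-∸ (node l r) m k {a} {b} (inj₁ t) =
  inj₁ (rootLeft-unshift m k _ (subst (λ ρ → RootLeft (m + k) ρ (m + a) (m + b)) (sym (shift-label m k (size l))) t))
leftDesc-∸ (node l r) m k (inj₂ (inj₁ x)) = inj₂ (inj₁ (leftDesc-∸ l m k x))
leftDesc-∸ (node l r) m k {a} {b} (inj₂ (inj₂ x)) =
  inj₂ (inj₂ (leftDesc-∸ r m _ (subst (λ k' → LeftDesc r k' (m + a) (m + b)) (sym (shift-label m k (size l))) x)))

onSpine-+ : ∀ T m k {b} → OnSpine T k b → OnSpine T (m + k) (m + b)
onSpine-+ (node l r) m k (inj₁ refl) = inj₁ (shift-label m k (size l))
onSpine-+ (node l r) m k (inj₂ o)    = inj₂ (onSpine-+ l m k o)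

onSpine-∸ : ∀ T m k {b} → OnSpine T (m + k) (m + b) → OnSpine T k b
onSpine-∸ (node l r) m k (inj₁ e) = inj₁ (+-cancelˡ-≡ m _ _ (trans e (sym (shift-label m k (size l)))))
onSpine-∸ (node l r) m k (inj₂ o) = inj₂ (onSpine-∸ l m k o)

relabel : (P : ℕ → ℕ → ℕ → Set) → ∀ n {a b} → n < a → n < b →
  P (n + 0) (n + (a ∸ n)) (n + (b ∸ n)) → P n a b
relabel P n n<a n<b x rewrite +-identityʳ n | m+[n∸m]≡n (<⇒≤ n<a) | m+[n∸m]≡n (<⇒≤ n<b) = x

unlabel : (P : ℕ → ℕ → ℕ → Set) → ∀ n {a b} → n < a → n < b →
  P n a b → P (n + 0) (n + (a ∸ n)) (n + (b ∸ n))
unlabel P n n<a n<b x rewrite +-identityʳ n | m+[n∸m]≡n (<⇒≤ n<a) | m+[n∸m]≡n (<⇒≤ n<b) = x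

rightDesc-shift : ∀ T n {a b} → n < a → n < b → RightDesc T 0 (a ∸ n) (b ∸ n) → RightDesc T n a b
rightDesc-shift T n n<a n<b x = relabel (RightDesc T) n n<a n<b (rightDesc-+ T n 0 x)

rightDesc-unshift : ∀ T n {a b} → n < a → n < b → RightDesc T n a b → RightDesc T 0 (a ∸ n) (b ∸ n)
rightDesc-unshift T n n<a n<b x = rightDesc-∸ T n 0 (unlabel (RightDesc T) n n<a n<b x)

leftDesc-shift : ∀ T n {a b} → n < a → n < b → LeftDesc T 0 (a ∸ n) (b ∸ n) → LeftDesc T n a b
leftDesc-shift T n n<a n<b x = relabel (LeftDesc T) n n<a n<b (leftDesc-+ T n 0 x)

leftDesc-unshift : ∀ T n {a b} → n < a → n < b → LeftDesc T n a b → LeftDesc T 0 (a ∸ n) (b ∸ n)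
leftDesc-unshift T n n<a n<b x = leftDesc-∸ T n 0 (unlabel (LeftDesc T) n n<a n<b x)

onSpine-shift : ∀ T n {b} → n < b → OnSpine T 0 (b ∸ n) → OnSpine T n b
onSpine-shift T n n<b o = relabel (λ k _ b → OnSpine T k b) n n<b n<b (onSpine-+ T n 0 o)

onSpine-unshift : ∀ T n {b} → n < b → OnSpine T n b → OnSpine T 0 (b ∸ n)
onSpine-unshift T n n<b o = onSpine-∸ T n 0 (unlabel (λ k _ b → OnSpine T k b) n n<b n<b o)

-- Descendants in graftLeft A S (labels from offset k): A keeps its labels,
-- S is shifted by size A, and in addition every node of A lies in the left
-- subtree of every node of the left spine of S.
graftLeft-root : ∀ A l k → k + size (graftLeft A l) + 1 ≡ k + size A + size l + 1
graftLeft-root A l k rewrite size-graftLeft A l = cong (_+ 1) (sym (+-assoc k (size A) (size l)))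

rightDesc-graftLeft⁻ : ∀ A S k {a b} → RightDesc (graftLeft A S) k a b →
  RightDesc A k a b ⊎ RightDesc S (k + size A) a b
rightDesc-graftLeft⁻ A leaf k x = inj₁ x
rightDesc-graftLeft⁻ A (node l r) k {a} {b} (inj₁ t) =
  inj₂ (inj₁ (subst (λ ρ → RootRight ρ (size r) a b) (graftLeft-root A l k) t))
rightDesc-graftLeft⁻ A (node l r) k (inj₂ (inj₁ x)) with rightDesc-graftLeft⁻ A l k x
... | inj₁ y = inj₁ y
... | inj₂ y = inj₂ (inj₂ (inj₁ y))
rightDesc-graftLeft⁻ A (node l r) k {a} {b} (inj₂ (inj₂ x)) =
  inj₂ (inj₂ (inj₂ (subst (λ k' → RightDesc r k' a b) (graftLeft-root A l k) x)))

rightDesc-graftLeft⁺ : ∀ A S k {a b} → RightDesc A k a b ⊎ RightDesc S (k + size A) a b →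
  RightDesc (graftLeft A S) k a b
rightDesc-graftLeft⁺ A leaf k (inj₁ x) = x
rightDesc-graftLeft⁺ A (node l r) k (inj₁ y) = inj₂ (inj₁ (rightDesc-graftLeft⁺ A l k (inj₁ y)))
rightDesc-graftLeft⁺ A (node l r) k {a} {b} (inj₂ (inj₁ t)) =
  inj₁ (subst (λ ρ → RootRight ρ (size r) a b) (sym (graftLeft-root A l k)) t)
rightDesc-graftLeft⁺ A (node l r) k (inj₂ (inj₂ (inj₁ x))) =
  inj₂ (inj₁ (rightDesc-graftLeft⁺ A l k (inj₂ x)))
rightDesc-graftLeft⁺ A (node l r) k {a} {b} (inj₂ (inj₂ (inj₂ x))) =
  inj₂ (inj₂ (subst (λ k' → RightDesc r k' a b) (sym (graftLeft-root A l k)) x))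

BelowSpine : Tree → Tree → ℕ → ℕ → ℕ → Set
BelowSpine A S k a b = k < a × a ≤ k + size A × OnSpine S (k + size A) b

leftDesc-graftLeft⁻ : ∀ A S k {a b} → LeftDesc (graftLeft A S) k a b →
  LeftDesc A k a b ⊎ LeftDesc S (k + size A) a b ⊎ BelowSpine A S k a b
leftDesc-graftLeft⁻ A leaf k x = inj₁ x
leftDesc-graftLeft⁻ A (node l r) k {a} {b} (inj₁ (e , k<a , a<ρ)) with a ≤? k + size A
... | yes a≤ = inj₂ (inj₂ (k<a , a≤ , inj₁ (trans e (graftLeft-root A l k))))
... | no a≰ = inj₂ (inj₁ (inj₁ (trans e (graftLeft-root A l k) , ≰⇒> a≰ ,
                                  subst (a <_) (graftLeft-root A l k) a<ρ)))
leftDesc-graftLeft⁻ A (node l r) k (inj₂ (inj₁ x)) with leftDesc-graftLeft⁻ A l k x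
... | inj₁ y                     = inj₁ y
... | inj₂ (inj₁ y)              = inj₂ (inj₁ (inj₂ (inj₁ y)))
... | inj₂ (inj₂ (k<a , a≤ , o)) = inj₂ (inj₂ (k<a , a≤ , inj₂ o))
leftDesc-graftLeft⁻ A (node l r) k {a} {b} (inj₂ (inj₂ x)) =
  inj₂ (inj₁ (inj₂ (inj₂ (subst (λ k' → LeftDesc r k' a b) (graftLeft-root A l k) x))))

leftDesc-graftLeft⁺ : ∀ A S k {a b} →
  LeftDesc A k a b ⊎ LeftDesc S (k + size A) a b ⊎ BelowSpine A S k a b →
  LeftDesc (graftLeft A S) k a b
leftDesc-graftLeft⁺ A leaf k (inj₁ x) = x
leftDesc-graftLeft⁺ A leaf k (inj₂ (inj₁ ()))
leftDesc-graftLeft⁺ A leaf k (inj₂ (inj₂ (_ , _ , ())))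
leftDesc-graftLeft⁺ A (node l r) k (inj₁ y) = inj₂ (inj₁ (leftDesc-graftLeft⁺ A l k (inj₁ y)))
leftDesc-graftLeft⁺ A (node l r) k {a} {b} (inj₂ (inj₁ (inj₁ (e , kA<a , a<ρ)))) =
  inj₁ (trans e (sym (graftLeft-root A l k)) , ≤-<-trans (m≤m+n k (size A)) kA<a ,
        subst (a <_) (sym (graftLeft-root A l k)) a<ρ)
leftDesc-graftLeft⁺ A (node l r) k (inj₂ (inj₁ (inj₂ (inj₁ x)))) =
  inj₂ (inj₁ (leftDesc-graftLeft⁺ A l k (inj₂ (inj₁ x))))
leftDesc-graftLeft⁺ A (node l r) k {a} {b} (inj₂ (inj₁ (inj₂ (inj₂ x)))) =
  inj₂ (inj₂ (subst (λ k' → LeftDesc r k' a b) (sym (graftLeft-root A l k)) x))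
leftDesc-graftLeft⁺ A (node l r) k {a} {b} (inj₂ (inj₂ (k<a , a≤ , inj₁ e))) =
  inj₁ (trans e (sym (graftLeft-root A l k)) , k<a ,
        subst (a <_) (sym (graftLeft-root A l k))
              (≤-<-trans a≤ (≤-<-trans (m≤m+n _ (size l)) (label<root _ (size l)))))
leftDesc-graftLeft⁺ A (node l r) k (inj₂ (inj₂ (k<a , a≤ , inj₂ o))) =
  inj₂ (inj₁ (leftDesc-graftLeft⁺ A l k (inj₂ (inj₂ (k<a , a≤ , o)))))

UpFromFirst : Tree → ℕ → ℕ → Set
UpFromFirst T k b = (b ≡ suc k × NonLeaf T) ⊎ LeftDesc T k (suc k) b

first-label : ∀ k → k + 0 + 1 ≡ suc k
first-label = solve-∀

second<root : ∀ k s → 0 < s → suc k < k + s + 1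
second<root k s 0<s = ≤-<-trans (subst (_≤ k + s) (+-comm k 1) (+-monoʳ-≤ k 0<s)) (label<root k s)

upFromFirst⇒onSpine : ∀ T k {b} → UpFromFirst T k b → OnSpine T k b
upFromFirst⇒onSpine (node leaf r) k (inj₁ (e , _)) = inj₁ (trans e (sym (first-label k)))
upFromFirst⇒onSpine (node (node a b) r) k (inj₁ (e , _)) =
  inj₂ (upFromFirst⇒onSpine (node a b) k (inj₁ (e , tt)))
upFromFirst⇒onSpine (node l r) k (inj₂ (inj₁ (e , _ , _))) = inj₁ e
upFromFirst⇒onSpine (node l r) k (inj₂ (inj₂ (inj₁ x))) = inj₂ (upFromFirst⇒onSpine l k (inj₂ x))
upFromFirst⇒onSpine (node l r) k (inj₂ (inj₂ (inj₂ x))) with leftDesc-bounds r _ x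
... | ρ<k+1 , _ = ⊥-elim (<-irrefl refl (≤-trans ρ<k+1 (offset<root k (size l))))

onSpine⇒upFromFirst : ∀ T k {b} → OnSpine T k b → UpFromFirst T k b
onSpine⇒upFromFirst (node leaf r) k (inj₁ e) = inj₁ (trans e (first-label k) , tt)
onSpine⇒upFromFirst (node (node a c) r) k (inj₁ e) =
  inj₂ (inj₁ (e , ≤-refl , second<root k _ (size-node-pos a c)))
onSpine⇒upFromFirst (node l r) k (inj₂ o) with onSpine⇒upFromFirst l k o
... | inj₁ (e , _) = inj₁ (e , tt)
... | inj₂ x       = inj₂ (inj₂ (inj₁ x))

-- leftBranch j S: the subtree hanging at depth j of the left spine of S;
-- after insertSpine j S it is the right subtree of the new node.
leftBranch : ℕ → Tree → Tree
leftBranch zero    S          = S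
leftBranch (suc j) leaf       = leaf
leftBranch (suc j) (node l r) = leftBranch j l

size-leftBranch : ∀ j S → size (leftBranch j S) ≤ size S
size-leftBranch zero    S          = ≤-refl
size-leftBranch (suc j) leaf       = ≤-refl
size-leftBranch (suc j) (node l r) = ≤-trans (size-leftBranch j l) (<⇒≤ (size-left< l r))

size-insertSpine : ∀ j S → size (insertSpine j S) ≡ suc (size S)
size-insertSpine zero    S          = refl
size-insertSpine (suc j) leaf       = refl
size-insertSpine (suc j) (node l r) = cong (λ s → s + 1 + size r) (size-insertSpine j l)

insertSpine-root : ∀ j l k → k + size (insertSpine j l) + 1 ≡ suc k + size l + 1
insertSpine-root j l k rewrite size-insertSpine j l = cong (_+ 1) (+-suc k (size l))

rightDesc-insertSpine⁻ : ∀ j S k {a b} → RightDesc (insertSpine j S) k a b →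
  RootRight (suc k) (size (leftBranch j S)) a b ⊎ RightDesc S (suc k) a b
rightDesc-insertSpine⁻ zero S k {a} {b} (inj₁ t) =
  inj₁ (subst (λ ρ → RootRight ρ (size S) a b) (first-label k) t)
rightDesc-insertSpine⁻ zero S k {a} {b} (inj₂ (inj₂ x)) =
  inj₂ (subst (λ k' → RightDesc S k' a b) (first-label k) x)
rightDesc-insertSpine⁻ (suc j) leaf k {a} {b} (inj₁ t) =
  inj₁ (subst (λ ρ → RootRight ρ 0 a b) (first-label k) t)
rightDesc-insertSpine⁻ (suc j) leaf k (inj₂ (inj₁ ()))
rightDesc-insertSpine⁻ (suc j) leaf k (inj₂ (inj₂ ()))
rightDesc-insertSpine⁻ (suc j) (node l r) k {a} {b} (inj₁ t) =
  inj₂ (inj₁ (subst (λ ρ → RootRight ρ (size r) a b) (insertSpine-root j l k) t))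
rightDesc-insertSpine⁻ (suc j) (node l r) k (inj₂ (inj₁ x)) with rightDesc-insertSpine⁻ j l k x
... | inj₁ t = inj₁ t
... | inj₂ y = inj₂ (inj₂ (inj₁ y))
rightDesc-insertSpine⁻ (suc j) (node l r) k {a} {b} (inj₂ (inj₂ x)) =
  inj₂ (inj₂ (inj₂ (subst (λ k' → RightDesc r k' a b) (insertSpine-root j l k) x)))

rightDesc-insertSpine⁺ : ∀ j S k {a b} →
  RootRight (suc k) (size (leftBranch j S)) a b ⊎ RightDesc S (suc k) a b →
  RightDesc (insertSpine j S) k a b
rightDesc-insertSpine⁺ zero S k {a} {b} (inj₁ t) =
  inj₁ (subst (λ ρ → RootRight ρ (size S) a b) (sym (first-label k)) t)
rightDesc-insertSpine⁺ zero S k {a} {b} (inj₂ x) =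
  inj₂ (inj₂ (subst (λ k' → RightDesc S k' a b) (sym (first-label k)) x))
rightDesc-insertSpine⁺ (suc j) leaf k {a} {b} (inj₁ t) =
  inj₁ (subst (λ ρ → RootRight ρ 0 a b) (sym (first-label k)) t)
rightDesc-insertSpine⁺ (suc j) (node l r) k (inj₁ t) = inj₂ (inj₁ (rightDesc-insertSpine⁺ j l k (inj₁ t)))
rightDesc-insertSpine⁺ (suc j) (node l r) k {a} {b} (inj₂ (inj₁ t)) =
  inj₁ (subst (λ ρ → RootRight ρ (size r) a b) (sym (insertSpine-root j l k)) t)
rightDesc-insertSpine⁺ (suc j) (node l r) k (inj₂ (inj₂ (inj₁ y))) =
  inj₂ (inj₁ (rightDesc-insertSpine⁺ j l k (inj₂ y)))
rightDesc-insertSpine⁺ (suc j) (node l r) k {a} {b} (inj₂ (inj₂ (inj₂ x))) =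
  inj₂ (inj₂ (subst (λ k' → RightDesc r k' a b) (sym (insertSpine-root j l k)) x))

spine-covers : ∀ T k b → k < b → b ≤ k + size T →
  Σ ℕ λ y → OnSpine T k y × (y ≡ b ⊎ RightDesc T k y b)
spine-covers leaf k b k<b b≤ = ⊥-elim (<-irrefl refl (<-≤-trans k<b (≤-trans b≤ (≤-reflexive (+-identityʳ k)))))
spine-covers (node l r) k b k<b b≤ with b ≤? k + size l
... | yes b≤l with spine-covers l k b k<b b≤l
...   | y , o , inj₁ e = y , inj₂ o , inj₁ e
...   | y , o , inj₂ x = y , inj₂ o , inj₂ (inj₂ (inj₁ x))
spine-covers (node l r) k b k<b b≤ | no b≰l with m≤n⇒m<n∨m≡n (≰⇒> b≰l)
... | inj₂ e  = _ , inj₁ refl , inj₁ (trans (+-comm _ 1) e)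
... | inj₁ lt = _ , inj₁ refl ,
                inj₂ (inj₁ (refl , subst (_< b) (+-comm 1 _) lt , ≤-trans b≤ (≤-reflexive (last-label k (size l) (size r)))))

leftBranch-rightDesc : ∀ j S k {a b} → RightDesc (leftBranch j S) k a b → RightDesc S k a b
leftBranch-rightDesc zero    S          k x = x
leftBranch-rightDesc (suc j) (node l r) k x = inj₂ (inj₁ (leftBranch-rightDesc j l k x))

rightDesc-leftBranch : ∀ j S k {y b} → OnSpine (leftBranch j S) k y → RightDesc S k y b →
  RightDesc (leftBranch j S) k y b
rightDesc-leftBranch zero    S          k o x = x
rightDesc-leftBranch (suc j) (node l r) k o (inj₂ (inj₁ x)) = rightDesc-leftBranch j l k o x
rightDesc-leftBranch (suc j) (node l r) k o (inj₁ (refl , _)) with onSpine-bounds (leftBranch j l) k o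
... | _ , y≤ = ⊥-elim (<-irrefl refl (≤-<-trans y≤ (≤-<-trans (+-monoʳ-≤ k (size-leftBranch j l)) (label<root k (size l)))))
rightDesc-leftBranch (suc j) (node l r) k o (inj₂ (inj₂ x))
  with onSpine-bounds (leftBranch j l) k o | rightDesc-bounds r _ x
... | _ , y≤ | ρ<y , _ , _ =
  ⊥-elim (<-irrefl refl (<-≤-trans ρ<y (≤-trans y≤ (≤-trans (+-monoʳ-≤ k (size-leftBranch j l)) (m≤m+n _ 1)))))

-- The left spine consists exactly of the nodes that are nobody's right
-- descendant: these are the decreasing roots of the interval.
onSpine⇒notRightDesc : ∀ T k {b} → OnSpine T k b → ∀ a → ¬ RightDesc T k a b
onSpine⇒notRightDesc (node l r) k (inj₁ refl) a (inj₁ (_ , ρ<ρ , _)) = <-irrefl refl ρ<ρ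
onSpine⇒notRightDesc (node l r) k (inj₁ refl) a (inj₂ (inj₁ x)) with rightDesc-bounds l k x
... | _ , _ , ρ≤ = <-irrefl refl (≤-<-trans ρ≤ (label<root k (size l)))
onSpine⇒notRightDesc (node l r) k (inj₁ refl) a (inj₂ (inj₂ x)) with rightDesc-bounds r _ x
... | ρ<a , a<ρ , _ = <-irrefl refl (<-trans ρ<a a<ρ)
onSpine⇒notRightDesc (node l r) k (inj₂ o) a (inj₁ (_ , ρ<b , _)) with onSpine-bounds l k o
... | _ , b≤ = <-irrefl refl (<-≤-trans ρ<b (≤-trans b≤ (<⇒≤ (label<root k (size l)))))
onSpine⇒notRightDesc (node l r) k (inj₂ o) a (inj₂ (inj₁ x)) = onSpine⇒notRightDesc l k o a x
onSpine⇒notRightDesc (node l r) k (inj₂ o) a (inj₂ (inj₂ x)) with onSpine-bounds l k o | rightDesc-bounds r _ x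
... | _ , b≤ | ρ<a , a<b , _ = <-irrefl refl (<-trans (<-trans ρ<a a<b) (≤-<-trans b≤ (label<root k (size l))))

notRightDesc⇒onSpine : ∀ T k b → k < b → b ≤ k + size T → (∀ a → ¬ RightDesc T k a b) → OnSpine T k b
notRightDesc⇒onSpine T k b k<b b≤ notDesc with spine-covers T k b k<b b≤
... | y , o , inj₁ refl = o
... | y , o , inj₂ x    = ⊥-elim (notDesc y x)

spineLabels : Tree → ℕ → List ℕ
spineLabels leaf       k = []
spineLabels (node l r) k = spineLabels l k ++ (k + size l + 1) ∷ []

∈spineLabels⇒onSpine : ∀ T k {b} → b ∈ spineLabels T k → OnSpine T k b
∈spineLabels⇒onSpine (node l r) k m with ∈-++⁻ (spineLabels l k) m
... | inj₁ m'       = inj₂ (∈spineLabels⇒onSpine l k m')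
... | inj₂ (here e) = inj₁ e

onSpine⇒∈spineLabels : ∀ T k {b} → OnSpine T k b → b ∈ spineLabels T k
onSpine⇒∈spineLabels (node l r) k (inj₁ e) = ∈-++⁺ʳ (spineLabels l k) (here e)
onSpine⇒∈spineLabels (node l r) k (inj₂ o) = ∈-++⁺ˡ (onSpine⇒∈spineLabels l k o)

linked-snoc : ∀ {xs x} → Linked _<_ xs → (∀ {z} → z ∈ xs → z < x) → Linked _<_ (xs ++ x ∷ [])
linked-snoc []      below = [-]
linked-snoc [-]     below = below (here refl) ∷ [-]
linked-snoc (p ∷ l) below = p ∷ linked-snoc l (λ m → below (there m))

spineLabels-increasing : ∀ T k → Linked _<_ (spineLabels T k)
spineLabels-increasing leaf       k = []
spineLabels-increasing (node l r) k =
  linked-snoc (spineLabels-increasing l k)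
    (λ m → ≤-<-trans (proj₂ (onSpine-bounds l k (∈spineLabels⇒onSpine l k m))) (label<root k (size l)))

length-spineLabels : ∀ T k → length (spineLabels T k) ≡ spineLength T
length-spineLabels leaf       k = refl
length-spineLabels (node l r) k =
  trans (length-++ (spineLabels l k)) (trans (+-comm _ 1) (cong suc (length-spineLabels l k)))

take-++ˡ : ∀ {A : Set} n (xs ys : List A) → n ≤ length xs → take n (xs ++ ys) ≡ take n xs
take-++ˡ zero    xs       ys _         = refl
take-++ˡ (suc n) (x ∷ xs) ys (s≤s n≤) = cong (x ∷_) (take-++ˡ n xs ys n≤)

take-spineLabels : ∀ j S k → take (spineLength S ∸ j) (spineLabels S k) ≡ spineLabels (leftBranch j S) k
take-spineLabels zero    S          k = take-all _ _ (≤-reflexive (length-spineLabels S k))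
take-spineLabels (suc j) leaf       k = refl
take-spineLabels (suc j) (node l r) k =
  trans (take-++ˡ (spineLength l ∸ j) (spineLabels l k) _
           (subst (spineLength l ∸ j ≤_) (sym (length-spineLabels l k)) (m∸n≤m (spineLength l) j)))
        (take-spineLabels j l k)

head-least : ∀ {x xs z} → Linked _<_ (x ∷ xs) → z ∈ xs → x < z
head-least (p ∷ l) (here refl) = p
head-least (p ∷ l) (there m)   = <-trans p (head-least l m)

increasing-unique : ∀ {xs ys} → Linked _<_ xs → Linked _<_ ys →
  (∀ {z} → z ∈ xs → z ∈ ys) → (∀ {z} → z ∈ ys → z ∈ xs) → xs ≡ ys
increasing-unique {[]}     {[]}     _  _  _  _  = refl
increasing-unique {[]}     {y ∷ ys} _  _  _  ys⊆ with ys⊆ (here refl)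
... | ()
increasing-unique {x ∷ xs} {[]}     _  _  xs⊆ _ with xs⊆ (here refl)
... | ()
increasing-unique {x ∷ xs} {y ∷ ys} lx ly xs⊆ ys⊆ =
  cong₂ _∷_ x≡y (increasing-unique (Linked.tail lx) (Linked.tail ly) tail⊆ tail⊇)
  where
  x≡y : x ≡ y
  x≡y with xs⊆ (here refl) | ys⊆ (here refl)
  ... | here e  | _       = e
  ... | there m | here e  = sym e
  ... | there m | there m' = ⊥-elim (<-irrefl refl (<-trans (head-least ly m) (head-least lx m')))
  tail⊆ : ∀ {z} → z ∈ xs → z ∈ ys
  tail⊆ m with xs⊆ (there m)
  ... | here e   = ⊥-elim (<-irrefl (trans x≡y (sym e)) (head-least lx m))
  ... | there m' = m'
  tail⊇ : ∀ {z} → z ∈ ys → z ∈ xs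
  tail⊇ m with ys⊆ (there m)
  ... | here e   = ⊥-elim (<-irrefl (trans (sym x≡y) (sym e)) (head-least ly m))
  ... | there m' = m'

nonLeaf-of-size : ∀ {n} T → size T ≡ n → 0 < n → NonLeaf T
nonLeaf-of-size leaf       refl ()
nonLeaf-of-size (node _ _) _    _ = tt

module Correspondence {n : ℕ} {R : Relℕ} {T₁ T₂ : Tree} (c : Corresponds n R T₁ T₂) where
  size-lower : size T₁ ≡ n
  size-lower = proj₁ c

  size-upper : size T₂ ≡ n
  size-upper = proj₁ (proj₂ c)

  decreasing : ∀ a b → a < b → R b a ⇔ RightDesc T₁ 0 a b
  decreasing = proj₁ (proj₂ (proj₂ c))

  increasing : ∀ a b → a < b → R a b ⇔ LeftDesc T₂ 0 a b
  increasing = proj₂ (proj₂ (proj₂ c))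

module LeftGrafting {n₁ n₂ : ℕ} {R₁ R₂ : Relℕ}
  (ip₁ : IsIntervalPoset n₁ R₁) (ip₂ : IsIntervalPoset n₂ R₂) (0<n₂ : 0 < n₂) where

  open IsIntervalPoset using (support; reflexive) renaming (trans to ◁-trans)

  LeftGraftStep : Relℕ
  LeftGraftStep a b = concatRel n₁ R₁ R₂ a b ⊎ (1 ≤ a × a ≤ n₁ × b ≡ suc n₁)

  -- Their transitive closure, computed: a node of I₁ lies below a node b of
  -- I₂ exactly when n₁ + 1 lies below b.
  LeftGraftRel : Relℕ
  LeftGraftRel a b =
    R₁ a b ⊎ (n₁ < a × n₁ < b × R₂ (a ∸ n₁) (b ∸ n₁)) ⊎ (1 ≤ a × a ≤ n₁ × n₁ < b × R₂ 1 (b ∸ n₁))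

  step⇒rel : ∀ {a b} → LeftGraftStep a b → LeftGraftRel a b
  step⇒rel (inj₁ (inj₁ r)) = inj₁ r
  step⇒rel (inj₁ (inj₂ s)) = inj₂ (inj₁ s)
  step⇒rel (inj₂ (1≤a , a≤n₁ , refl)) =
    inj₂ (inj₂ (1≤a , a≤n₁ , ≤-refl , subst (R₂ 1) (sym (m+n∸n≡m 1 n₁)) (reflexive ip₂ ≤-refl 0<n₂)))

  bounded₁ : ∀ {a b} → R₁ a b → a ≤ n₁ × b ≤ n₁
  bounded₁ r = proj₂ (proj₁ (support ip₁ r)) , proj₂ (proj₂ (support ip₁ r))

  rel-trans : ∀ {a b c} → LeftGraftRel a b → LeftGraftRel b c → LeftGraftRel a c
  rel-trans (inj₁ r) (inj₁ r') = inj₁ (◁-trans ip₁ r r')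
  rel-trans (inj₁ r) (inj₂ (inj₁ (n₁<b , _ , _))) = ⊥-elim (<⇒≱ n₁<b (proj₂ (bounded₁ r)))
  rel-trans (inj₁ r) (inj₂ (inj₂ (_ , _ , n₁<c , s))) =
    inj₂ (inj₂ (proj₁ (proj₁ (support ip₁ r)) , proj₁ (bounded₁ r) , n₁<c , s))
  rel-trans (inj₂ (inj₁ (_ , n₁<b , _))) (inj₁ r) = ⊥-elim (<⇒≱ n₁<b (proj₁ (bounded₁ r)))
  rel-trans (inj₂ (inj₁ (n₁<a , _ , s))) (inj₂ (inj₁ (_ , n₁<c , s'))) = inj₂ (inj₁ (n₁<a , n₁<c , ◁-trans ip₂ s s'))
  rel-trans (inj₂ (inj₁ (_ , n₁<b , _))) (inj₂ (inj₂ (_ , b≤n₁ , _ , _))) = ⊥-elim (<⇒≱ n₁<b b≤n₁)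
  rel-trans (inj₂ (inj₂ (_ , _ , n₁<b , _))) (inj₁ r) = ⊥-elim (<⇒≱ n₁<b (proj₁ (bounded₁ r)))
  rel-trans (inj₂ (inj₂ (1≤a , a≤n₁ , _ , s))) (inj₂ (inj₁ (_ , n₁<c , s'))) =
    inj₂ (inj₂ (1≤a , a≤n₁ , n₁<c , ◁-trans ip₂ s s'))
  rel-trans (inj₂ (inj₂ (_ , _ , n₁<b , _))) (inj₂ (inj₂ (_ , b≤n₁ , _ , _))) = ⊥-elim (<⇒≱ n₁<b b≤n₁)

  leftGraft⇒rel : ∀ {a b} → leftGraft n₁ R₁ R₂ a b → LeftGraftRel a b
  leftGraft⇒rel [ x ]   = step⇒rel x
  leftGraft⇒rel (x ∷ t) = rel-trans (step⇒rel x) (leftGraft⇒rel t)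

  rel⇒leftGraft : ∀ {a b} → LeftGraftRel a b → leftGraft n₁ R₁ R₂ a b
  rel⇒leftGraft (inj₁ r)        = [ inj₁ (inj₁ r) ]
  rel⇒leftGraft (inj₂ (inj₁ s)) = [ inj₁ (inj₂ s) ]
  rel⇒leftGraft {b = b} (inj₂ (inj₂ (1≤a , a≤n₁ , n₁<b , s))) =
    inj₂ (1≤a , a≤n₁ , refl) ∷ [ inj₁ (inj₂ (≤-refl , n₁<b , subst (λ x → R₂ x (b ∸ n₁)) (sym (m+n∸n≡m 1 n₁)) s)) ]

  module _ {A₁ A₂ S₁ S₂ : Tree} (c₁ : Corresponds n₁ R₁ A₁ A₂) (c₂ : Corresponds n₂ R₂ S₁ S₂) where
    open Correspondence c₁ renaming (size-lower to sA₁; size-upper to sA₂; decreasing to dec₁; increasing to inc₁)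
    open Correspondence c₂ renaming (size-lower to sS₁; size-upper to sS₂; decreasing to dec₂; increasing to inc₂)

    decreasing⇒ : ∀ a b → a < b → leftGraft n₁ R₁ R₂ b a → RightDesc (graftLeft A₁ S₁) 0 a b
    decreasing⇒ a b a<b t with leftGraft⇒rel t
    ... | inj₁ r = rightDesc-graftLeft⁺ A₁ S₁ 0 (inj₁ (Equivalence.to (dec₁ a b a<b) r))
    ... | inj₂ (inj₁ (n₁<b , n₁<a , s)) =
      rightDesc-graftLeft⁺ A₁ S₁ 0 (inj₂ (subst (λ k → RightDesc S₁ k a b) (sym sA₁)
        (rightDesc-shift S₁ n₁ n₁<a n₁<b (Equivalence.to (dec₂ _ _ (∸-monoˡ-< a<b (<⇒≤ n₁<a))) s))))
    ... | inj₂ (inj₂ (_ , b≤n₁ , n₁<a , _)) = ⊥-elim (<⇒≱ n₁<a (<⇒≤ (<-≤-trans a<b b≤n₁)))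

    decreasing⇐ : ∀ a b → a < b → RightDesc (graftLeft A₁ S₁) 0 a b → leftGraft n₁ R₁ R₂ b a
    decreasing⇐ a b a<b x with rightDesc-graftLeft⁻ A₁ S₁ 0 x
    ... | inj₁ y = rel⇒leftGraft (inj₁ (Equivalence.from (dec₁ a b a<b) y))
    ... | inj₂ y with subst (λ k → RightDesc S₁ k a b) sA₁ y
    ... | y' with rightDesc-bounds S₁ n₁ y'
    ... | n₁<a , _ = rel⇒leftGraft (inj₂ (inj₁ (<-trans n₁<a a<b , n₁<a ,
            Equivalence.from (dec₂ _ _ (∸-monoˡ-< a<b (<⇒≤ n₁<a)))
              (rightDesc-unshift S₁ n₁ n₁<a (<-trans n₁<a a<b) y'))))

    -- n₁ + 1 is the first node of the non-empty tree S₂ (shifted), so the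
    -- nodes above it are the left spine of S₂.
    increasing⇒ : ∀ a b → a < b → leftGraft n₁ R₁ R₂ a b → LeftDesc (graftLeft A₂ S₂) 0 a b
    increasing⇒ a b a<b t with leftGraft⇒rel t
    ... | inj₁ r = leftDesc-graftLeft⁺ A₂ S₂ 0 (inj₁ (Equivalence.to (inc₁ a b a<b) r))
    ... | inj₂ (inj₁ (n₁<a , n₁<b , s)) =
      leftDesc-graftLeft⁺ A₂ S₂ 0 (inj₂ (inj₁ (subst (λ k → LeftDesc S₂ k a b) (sym sA₂)
        (leftDesc-shift S₂ n₁ n₁<a n₁<b (Equivalence.to (inc₂ _ _ (∸-monoˡ-< a<b (<⇒≤ n₁<a))) s)))))
    ... | inj₂ (inj₂ (1≤a , a≤n₁ , n₁<b , s)) =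
      leftDesc-graftLeft⁺ A₂ S₂ 0 (inj₂ (inj₂ (1≤a , subst (a ≤_) (sym sA₂) a≤n₁ ,
        subst (λ k → OnSpine S₂ k b) (sym sA₂) (onSpine-shift S₂ n₁ n₁<b onSpine))))
      where
      onSpine : OnSpine S₂ 0 (b ∸ n₁)
      onSpine with m≤n⇒m<n∨m≡n (m<n⇒0<n∸m n₁<b)
      ... | inj₁ 1<b' = upFromFirst⇒onSpine S₂ 0 (inj₂ (Equivalence.to (inc₂ 1 _ 1<b') s))
      ... | inj₂ 1≡b' = upFromFirst⇒onSpine S₂ 0 (inj₁ (sym 1≡b' , nonLeaf-of-size S₂ sS₂ 0<n₂))

    increasing⇐ : ∀ a b → a < b → LeftDesc (graftLeft A₂ S₂) 0 a b → leftGraft n₁ R₁ R₂ a b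
    increasing⇐ a b a<b x with leftDesc-graftLeft⁻ A₂ S₂ 0 x
    ... | inj₁ y = rel⇒leftGraft (inj₁ (Equivalence.from (inc₁ a b a<b) y))
    ... | inj₂ (inj₁ y) with subst (λ k → LeftDesc S₂ k a b) sA₂ y
    ... | y' with leftDesc-bounds S₂ n₁ y'
    ... | n₁<a , _ = rel⇒leftGraft (inj₂ (inj₁ (n₁<a , <-trans n₁<a a<b ,
            Equivalence.from (inc₂ _ _ (∸-monoˡ-< a<b (<⇒≤ n₁<a)))
              (leftDesc-unshift S₂ n₁ n₁<a (<-trans n₁<a a<b) y'))))
    increasing⇐ a b a<b x | inj₂ (inj₂ (1≤a , a≤ , o)) with subst (λ k → OnSpine S₂ k b) sA₂ o
    ... | o' with onSpine-bounds S₂ n₁ o'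
    ... | n₁<b , _ = rel⇒leftGraft (inj₂ (inj₂ (1≤a , subst (a ≤_) sA₂ a≤ , n₁<b , first≤b)))
      where
      first≤b : R₂ 1 (b ∸ n₁)
      first≤b with onSpine⇒upFromFirst S₂ 0 (onSpine-unshift S₂ n₁ n₁<b o')
      ... | inj₁ (e , _) = subst (R₂ 1) (sym e) (reflexive ip₂ ≤-refl 0<n₂)
      ... | inj₂ y = Equivalence.from (inc₂ 1 _ (proj₁ (proj₂ (leftDesc-bounds S₂ 0 y)))) y

    corresponds : Corresponds (n₁ + n₂) (leftGraft n₁ R₁ R₂) (graftLeft A₁ S₁) (graftLeft A₂ S₂)
    corresponds =
      trans (size-graftLeft A₁ S₁) (cong₂ _+_ sA₁ sS₁) ,
      trans (size-graftLeft A₂ S₂) (cong₂ _+_ sA₂ sS₂) ,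
      (λ a b a<b → mk⇔ (decreasing⇒ a b a<b) (decreasing⇐ a b a<b)) ,
      (λ a b a<b → mk⇔ (increasing⇒ a b a<b) (increasing⇐ a b a<b))

module RightGrafting {n₂ : ℕ} {R₂ : Relℕ} {ys : List ℕ}
  (ip₂ : IsIntervalPoset n₂ R₂) (roots : DecRoots n₂ R₂ ys)
  {S₁ S₂ : Tree} (c₂ : Corresponds n₂ R₂ S₁ S₂) where

  open IsIntervalPoset using (reflexive) renaming (trans to ◁-trans)
  open Correspondence c₂ renaming (size-lower to sS₁; size-upper to sS₂; decreasing to dec₂; increasing to inc₂)

  roots≡spineLabels : ys ≡ spineLabels S₁ 0
  roots≡spineLabels = increasing-unique (proj₁ roots) (spineLabels-increasing S₁ 0) root⇒spine spine⇒root
    where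
    root⇒spine : ∀ {y} → y ∈ ys → y ∈ spineLabels S₁ 0
    root⇒spine {y} m with Equivalence.to (proj₂ roots y) m
    ... | 1≤y , y≤n₂ , noneAbove =
      onSpine⇒∈spineLabels S₁ 0 (notRightDesc⇒onSpine S₁ 0 y 1≤y (subst (y ≤_) (sym sS₁) y≤n₂)
        (λ a x → let a<y = proj₁ (proj₂ (rightDesc-bounds S₁ 0 x))
                 in noneAbove a a<y (Equivalence.from (dec₂ a y a<y) x)))
    spine⇒root : ∀ {y} → y ∈ spineLabels S₁ 0 → y ∈ ys
    spine⇒root {y} m with ∈spineLabels⇒onSpine S₁ 0 m
    ... | o = Equivalence.from (proj₂ roots y)
                (proj₁ (onSpine-bounds S₁ 0 o) , subst (y ≤_) sS₁ (proj₂ (onSpine-bounds S₁ 0 o)) ,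
                 λ a a<y r → onSpine⇒notRightDesc S₁ 0 o a (Equivalence.to (dec₂ a y a<y) r))

  contacts≡spineLength : length ys ≡ spineLength S₁
  contacts≡spineLength = trans (cong length roots≡spineLabels) (length-spineLabels S₁ 0)

  module _ {i : ℕ} (i≤c : i ≤ length ys) where

    -- depth of the inserted node, and the subtree that becomes its right subtree
    j : ℕ
    j = length ys ∸ i

    D : Tree
    D = leftBranch j S₁

    take-roots : take i ys ≡ spineLabels D 0
    take-roots = begin
      take i ys                                     ≡⟨ cong (λ n → take n ys) (sym (m∸[m∸n]≡n i≤c)) ⟩
      take (length ys ∸ j) ys                       ≡⟨ cong (λ n → take (n ∸ j) ys) contacts≡spineLength ⟩
      take (spineLength S₁ ∸ j) ys                  ≡⟨ cong (take _) roots≡spineLabels ⟩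
      take (spineLength S₁ ∸ j) (spineLabels S₁ 0)  ≡⟨ take-spineLabels j S₁ 0 ⟩
      spineLabels D 0                               ∎
      where open ≡-Reasoning

    chosen⇒onSpine : ∀ {y} → y ∈ take i ys → OnSpine D 0 y
    chosen⇒onSpine m = ∈spineLabels⇒onSpine D 0 (subst (_ ∈_) take-roots m)

    onSpine⇒chosen : ∀ {y} → OnSpine D 0 y → y ∈ take i ys
    onSpine⇒chosen o = subst (_ ∈_) (sym take-roots) (onSpine⇒∈spineLabels D 0 o)

    size-D≤ : size D ≤ n₂
    size-D≤ = subst (size D ≤_) sS₁ (size-leftBranch j S₁)

    belowChosen⇒ : ∀ {b y} → y ∈ take i ys → R₂ b y → b ≤ size D
    belowChosen⇒ {b} {y} m r with onSpine-bounds D 0 (chosen⇒onSpine m) | <-cmp b y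
    ... | _ , y≤ | tri< b<y _ _ = ≤-trans (<⇒≤ b<y) y≤
    ... | _ , y≤ | tri≈ _ refl _ = y≤
    ... | _ , y≤ | tri> _ _ y<b =
      proj₂ (proj₂ (rightDesc-bounds D 0
        (rightDesc-leftBranch j S₁ 0 (chosen⇒onSpine m) (Equivalence.to (dec₂ y b y<b) r))))

    belowChosen⇐ : ∀ {b} → 0 < b → b ≤ size D → Σ ℕ λ y → y ∈ take i ys × R₂ b y
    belowChosen⇐ {b} 0<b b≤ with spine-covers D 0 b 0<b b≤
    ... | y , o , inj₁ refl = y , onSpine⇒chosen o , reflexive ip₂ 0<b (≤-trans b≤ size-D≤)
    ... | y , o , inj₂ x    = y , onSpine⇒chosen o ,
      Equivalence.from (dec₂ y b (proj₁ (proj₂ (rightDesc-bounds D 0 x)))) (leftBranch-rightDesc j S₁ 0 x)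

    RightGraftStep : Relℕ
    RightGraftStep a b = concatRel 1 uRel R₂ a b ⊎ (b ≡ 1 × Σ ℕ λ y → y ∈ take i ys × a ≡ 1 + y)

    RightGraftRel : Relℕ
    RightGraftRel a b =
      uRel a b ⊎ (1 < a × 1 < b × R₂ (a ∸ 1) (b ∸ 1))
      ⊎ (b ≡ 1 × 1 < a × Σ ℕ λ y → y ∈ take i ys × R₂ (a ∸ 1) y)

    step⇒rel : ∀ {a b} → RightGraftStep a b → RightGraftRel a b
    step⇒rel (inj₁ (inj₁ u)) = inj₁ u
    step⇒rel (inj₁ (inj₂ s)) = inj₂ (inj₁ s)
    step⇒rel (inj₂ (b≡1 , y , m , refl)) with onSpine-bounds D 0 (chosen⇒onSpine m)
    ... | 0<y , y≤ = inj₂ (inj₂ (b≡1 , s≤s 0<y , y , m , reflexive ip₂ 0<y (≤-trans y≤ size-D≤)))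

    rel-trans : ∀ {a b c} → RightGraftRel a b → RightGraftRel b c → RightGraftRel a c
    rel-trans (inj₁ u) (inj₁ u') = inj₁ (proj₁ u , proj₂ u')
    rel-trans (inj₁ (_ , refl)) (inj₂ (inj₁ (1<1 , _ , _)))  = ⊥-elim (<-irrefl refl 1<1)
    rel-trans (inj₁ (_ , refl)) (inj₂ (inj₂ (_ , 1<1 , _)))  = ⊥-elim (<-irrefl refl 1<1)
    rel-trans (inj₂ (inj₁ (_ , 1<1 , _))) (inj₁ (refl , _))  = ⊥-elim (<-irrefl refl 1<1)
    rel-trans (inj₂ (inj₁ (1<a , _ , s))) (inj₂ (inj₁ (_ , 1<c , s'))) = inj₂ (inj₁ (1<a , 1<c , ◁-trans ip₂ s s'))
    rel-trans (inj₂ (inj₁ (1<a , _ , s))) (inj₂ (inj₂ (c≡1 , _ , y , m , s'))) =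
      inj₂ (inj₂ (c≡1 , 1<a , y , m , ◁-trans ip₂ s s'))
    rel-trans (inj₂ (inj₂ (refl , 1<a , w))) (inj₁ (_ , c≡1)) = inj₂ (inj₂ (c≡1 , 1<a , w))
    rel-trans (inj₂ (inj₂ (refl , _ , _))) (inj₂ (inj₁ (1<1 , _ , _))) = ⊥-elim (<-irrefl refl 1<1)
    rel-trans (inj₂ (inj₂ (refl , _ , _))) (inj₂ (inj₂ (_ , 1<1 , _))) = ⊥-elim (<-irrefl refl 1<1)

    rightGraft⇒rel : ∀ {a b} → rightGraft 1 uRel R₂ ys i a b → RightGraftRel a b
    rightGraft⇒rel [ x ]   = step⇒rel x
    rightGraft⇒rel (x ∷ t) = rel-trans (step⇒rel x) (rightGraft⇒rel t)

    rel⇒rightGraft : ∀ {a b} → RightGraftRel a b → rightGraft 1 uRel R₂ ys i a b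
    rel⇒rightGraft (inj₁ u)        = [ inj₁ (inj₁ u) ]
    rel⇒rightGraft (inj₂ (inj₁ s)) = [ inj₁ (inj₂ s) ]
    rel⇒rightGraft (inj₂ (inj₂ (refl , 1<a , y , m , s))) with onSpine-bounds D 0 (chosen⇒onSpine m)
    ... | 0<y , _ = inj₁ (inj₂ (1<a , s≤s 0<y , s)) ∷ [ inj₂ (refl , y , m , refl) ]

    -- The new node 1 has as right descendants the nodes 1 + b' of D (those
    -- below a chosen root); all other relations are those of I₂ shifted by one.
    decreasing⇒ : ∀ a b → a < b → rightGraft 1 uRel R₂ ys i b a → RightDesc (insertSpine j S₁) 0 a b
    decreasing⇒ a b a<b t with rightGraft⇒rel t
    ... | inj₁ (refl , refl) = ⊥-elim (<-irrefl refl a<b)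
    decreasing⇒ (suc a') (suc b') a<b t | inj₂ (inj₁ (_ , _ , s)) =
      rightDesc-insertSpine⁺ j S₁ 0 (inj₂ (rightDesc-+ S₁ 1 0 (Equivalence.to (dec₂ a' b' (≤-pred a<b)) s)))
    decreasing⇒ zero _ a<b t | inj₂ (inj₁ (_ , () , _))
    decreasing⇒ a (suc b') a<b t | inj₂ (inj₂ (refl , 1<b , y , m , s)) =
      rightDesc-insertSpine⁺ j S₁ 0 (inj₁ (refl , 1<b , s≤s (belowChosen⇒ m s)))

    decreasing⇐ : ∀ a b → a < b → RightDesc (insertSpine j S₁) 0 a b → rightGraft 1 uRel R₂ ys i b a
    decreasing⇐ a (suc b') a<b x with rightDesc-insertSpine⁻ j S₁ 0 x
    ... | inj₁ (refl , 1<b , b≤) with belowChosen⇐ (≤-pred 1<b) (≤-pred b≤)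
    ...   | y , m , r = rel⇒rightGraft (inj₂ (inj₂ (refl , 1<b , y , m , r)))
    decreasing⇐ (suc a') (suc b') a<b x | inj₂ y with rightDesc-bounds S₁ 1 y
    ... | 1<a , _ = rel⇒rightGraft (inj₂ (inj₁ (<-trans 1<a a<b , 1<a ,
                      Equivalence.from (dec₂ a' b' (≤-pred a<b)) (rightDesc-∸ S₁ 1 0 y))))
    decreasing⇐ zero (suc b') a<b x | inj₂ y with rightDesc-bounds S₁ 1 y
    ... | () , _

    increasing⇒ : ∀ a b → a < b → rightGraft 1 uRel R₂ ys i a b → LeftDesc (node leaf S₂) 0 a b
    increasing⇒ a b a<b t with rightGraft⇒rel t
    ... | inj₁ (refl , refl) = ⊥-elim (<-irrefl refl a<b)
    increasing⇒ (suc a') (suc b') a<b t | inj₂ (inj₁ (_ , _ , s)) =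
      inj₂ (inj₂ (leftDesc-+ S₂ 1 0 (Equivalence.to (inc₂ a' b' (≤-pred a<b)) s)))
    increasing⇒ zero _ a<b t | inj₂ (inj₁ (() , _))
    increasing⇒ a b a<b t | inj₂ (inj₂ (refl , 1<a , _)) = ⊥-elim (<-irrefl refl (<-trans 1<a a<b))

    increasing⇐ : ∀ a b → a < b → LeftDesc (node leaf S₂) 0 a b → rightGraft 1 uRel R₂ ys i a b
    increasing⇐ a b a<b (inj₁ (refl , 0<a , a<1)) = ⊥-elim (<⇒≱ 0<a (≤-pred a<1))
    increasing⇐ (suc a') (suc b') a<b (inj₂ (inj₂ x)) with leftDesc-bounds S₂ 1 x
    ... | 1<a , _ = rel⇒rightGraft (inj₂ (inj₁ (1<a , <-trans 1<a a<b ,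
                      Equivalence.from (inc₂ a' b' (≤-pred a<b)) (leftDesc-∸ S₂ 1 0 x))))
    increasing⇐ zero b a<b (inj₂ (inj₂ x)) with leftDesc-bounds S₂ 1 x
    ... | () , _

    corresponds : Corresponds (1 + n₂) (rightGraft 1 uRel R₂ ys i) (insertSpine j S₁) (node leaf S₂)
    corresponds =
      trans (size-insertSpine j S₁) (cong suc sS₁) , cong suc sS₂ ,
      (λ a b a<b → mk⇔ (decreasing⇒ a b a<b) (decreasing⇐ a b a<b)) ,
      (λ a b a<b → mk⇔ (increasing⇒ a b a<b) (increasing⇐ a b a<b))

dist-leftGraft : ∀ (n₁ n₂ : ℕ) (R₁ R₂ : Relℕ) (d₁ d₂ : ℕ)
  → IsIntervalPoset n₁ R₁ → IsIntervalPoset n₂ R₂ → 0 < n₂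
  → DistIs n₁ R₁ d₁ → DistIs n₂ R₂ d₂
  → DistIs (n₁ + n₂) (leftGraft n₁ R₁ R₂) (d₁ + d₂)
dist-leftGraft n₁ n₂ R₁ R₂ d₁ d₂ ip₁ ip₂ 0<n₂ (A₁ , A₂ , c₁ , maxA) (S₁ , S₂ , c₂ , maxS) =
  graftLeft A₁ S₁ , graftLeft A₂ S₂ , LeftGrafting.corresponds ip₁ ip₂ 0<n₂ c₁ c₂ ,
  graftLeft-maxChain A₁ A₂ S₁ S₂ d₁ d₂
    (nonLeaf-of-size S₁ size-lower₂ 0<n₂) (nonLeaf-of-size S₂ size-upper₂ 0<n₂)
    (trans size-lower₁ (sym size-bounded₁)) maxA maxS
  where
  open Correspondence c₁ renaming (size-lower to size-lower₁; size-upper to size-bounded₁)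
  open Correspondence c₂ renaming (size-lower to size-lower₂; size-upper to size-upper₂)

dist-rightGraft : ∀ (n₂ : ℕ) (R₂ : Relℕ) (d₂ : ℕ) (ys : List ℕ) (i : ℕ)
  → IsIntervalPoset n₂ R₂ → DecRoots n₂ R₂ ys → i ≤ length ys
  → DistIs n₂ R₂ d₂
  → DistIs (1 + n₂) (rightGraft 1 uRel R₂ ys i) (d₂ + length ys ∸ i)
dist-rightGraft n₂ R₂ d₂ ys i ip₂ roots i≤c (S₁ , S₂ , c₂ , maxS) =
  insertSpine j S₁ , node leaf S₂ , RightGrafting.corresponds ip₂ roots c₂ i≤c ,
  subst (MaxChainLength (insertSpine j S₁) (node leaf S₂)) j+d₂≡
    (insertSpine-maxChain j S₁ S₂ d₂ j≤spine maxS)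
  where
  j = length ys ∸ i
  j≤spine : j ≤ spineLength S₁
  j≤spine = subst (j ≤_) (RightGrafting.contacts≡spineLength ip₂ roots c₂) (m∸n≤m (length ys) i)
  j+d₂≡ : j + d₂ ≡ d₂ + length ys ∸ i
  j+d₂≡ = trans (+-comm j d₂) (sym (+-∸-assoc d₂ i≤c))

proposition4p7 :
    (∀ (n₁ n₂ : ℕ) (R₁ R₂ : Relℕ) (d₁ d₂ : ℕ)
       → IsIntervalPoset n₁ R₁ → IsIntervalPoset n₂ R₂ → 0 < n₂
       → DistIs n₁ R₁ d₁ → DistIs n₂ R₂ d₂
       → DistIs (n₁ + n₂) (leftGraft n₁ R₁ R₂) (d₁ + d₂))
    × (∀ (n₂ : ℕ) (R₂ : Relℕ) (d₂ : ℕ) (ys : List ℕ) (i : ℕ)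
       → IsIntervalPoset n₂ R₂ → DecRoots n₂ R₂ ys → i ≤ length ys
       → DistIs n₂ R₂ d₂
       → DistIs (1 + n₂) (rightGraft 1 uRel R₂ ys i) (d₂ + length ys ∸ i))
proposition4p7 = dist-leftGraft , dist-rightGraft
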